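{- There exists a family of $2$-degenerate graphs $G$ with $\operatorname{mad}(G)<4$ and arbitrarily large maximum degree such that $\chi(G^2)\geqslant \frac{5\Delta(G)}{2}$. That is, for every integer $N$ there is a finite $2$-degenerate graph $G$ with $\operatorname{mad}(G)<4$, $\Delta(G)\geqslant N$, and $\chi(G^2)\geqslant \frac{5\Delta(G)}{2}$.
   Context: $\Delta(G)$ is the maximum degree of $G$. A graph is $2$-degenerate if every nonempty subgraph has a vertex of degree at most $2$. The maximum average degree is $\operatorname{mad}(G)=\max\{2|E(H)|/|V(H)| : H \subseteq G\}$ over (nonempty) subgraphs $H$ of $G$. The square $G^2$ is the graph on $V(G)$ in which two distinct vertices are adjacent if and only if their distance in $G$ is at most $2$; $\chi(G^2)$ is its chromatic number. -}

module Defs where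

open import Data.Nat using (ℕ; _+_; _*_; _⊔_; _<_; _≤_)
open import Data.Bool using (Bool; true; false; if_then_else_; _∧_)
open import Data.Fin using (Fin)
import Data.Fin as F
open import Data.List using (List; map; foldr; allFin)
open import Data.Nat.ListAction using (sum)
open import Data.Nat using (_<ᵇ_)
open import Data.Product using (Σ; ∃; _×_)
open import Relation.Binary.PropositionalEquality using (_≡_)
open import Relation.Nullary using (¬_)

record Graph : Set where
  field
    n     : ℕ
    adj   : Fin n → Fin n → Bool
    sym   : ∀ u v → adj u v ≡ adj v u
    irrefl : ∀ v → adj v v ≡ false
open Graph public

count : {m : ℕ} → (Fin m → Bool) → ℕ
count {m} p = sum (map (λ v → if p v then 1 else 0) (allFin m))

degree : (G : Graph) → Fin (n G) → ℕ
degree G u = count (adj G u)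

-- maximum degree Δ(G) (0 for the empty graph)
Δ : Graph → ℕ
Δ G = foldr _⊔_ 0 (map (degree G) (allFin (n G)))

record Subgraph (G : Graph) : Set where
  field
    V  : Fin (n G) → Bool
    E  : Fin (n G) → Fin (n G) → Bool
    E-sym : ∀ u v → E u v ≡ E v u
    E⊆ : ∀ u v → E u v ≡ true → (adj G u v ≡ true) × (V u ≡ true) × (V v ≡ true)
open Subgraph public

|V| : {G : Graph} → Subgraph G → ℕ
|V| H = count (V H)

degH : {G : Graph} → Subgraph G → Fin (n G) → ℕ
degH H u = count (E H u)

|E| : {G : Graph} → Subgraph G → ℕ
|E| {G} H = sum (map (λ u → count (λ v → if F.toℕ u <ᵇ F.toℕ v then E H u v else false)) (allFin (n G)))

Nonempty : {G : Graph} → Subgraph G → Set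
Nonempty H = ∃ λ v → V H v ≡ true

TwoDegenerate : Graph → Set
TwoDegenerate G = (H : Subgraph G) → Nonempty H →
  ∃ λ v → (V H v ≡ true) × (degH H v ≤ 2)

-- mad(G) < 4 : the maximum over (finitely many) nonempty subgraphs H of
-- 2|E(H)|/|V(H)| is < 4, i.e. 2|E(H)| < 4|V(H)| for every nonempty H.
MadLessThan4 : Graph → Set
MadLessThan4 G = (H : Subgraph G) → Nonempty H → 2 * |E| H < 4 * |V| H

AdjSq : (G : Graph) → Fin (n G) → Fin (n G) → Set
AdjSq G u v = ¬ (u ≡ v) ×
  ((adj G u v ≡ true) ⊎' (∃ λ w → (adj G u w ≡ true) × (adj G w v ≡ true)))
  where
  open import Data.Sum using () renaming (_⊎_ to _⊎'_)

ProperSqColouring : (G : Graph) (k : ℕ) → (Fin (n G) → Fin k) → Set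
ProperSqColouring G k c = ∀ u v → AdjSq G u v → ¬ (c u ≡ c v)

-- χ(G²) ≥ m  (encoded as 2·χ(G²) ≥ m' below): every proper colouring
-- of G² with k colours has  5Δ(G) ≤ 2k,  i.e.  χ(G²) ≥ 5Δ(G)/2.
ChiSqAtLeast5Δ/2 : Graph → Set
ChiSqAtLeast5Δ/2 G = ∀ k (c : Fin (n G) → Fin k) → ProperSqColouring G k c → 5 * Δ G ≤ 2 * k

-- For t ≥ 2 take the five vertices of K₅ as hubs, t vertices mid e i adjacent to both ends of each
-- edge e of K₅, and, for each of the 15 pairs {e, e'} of disjoint edges and all i, j, a bridge
-- adjacent to mid e i and mid e' j.  Hubs have degree 4t, mids 2 + 3t and bridges 2, so Δ = 4t.
-- Two mids are at distance at most 2, via a common hub if their edges meet and via a bridge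
-- otherwise, so the 10t mids form a clique in G² and χ(G²) ≥ 10t = 5Δ/2.
-- Numbering bridges first, then mids, then hubs, every vertex has at most two neighbours later in
-- the numbering.  Hence the first vertex of a nonempty subgraph H has degree at most 2 in H, and
-- counting every edge of H at its earlier end gives |E(H)| ≤ 2|V(H)| − 2, since the last vertex of
-- H counts nothing; so mad(G) < 4.

module Submission where

open import Defs hiding (sym)

open import Data.Bool using (Bool; true; false; if_then_else_)
open import Data.Bool.Properties using (T-≡)
open import Data.Empty using (⊥-elim)
open import Data.Fin as Fin using (Fin; zero; suc; toℕ; #_; splitAt; _↑ˡ_; _↑ʳ_; combine; remQuot)
import Data.Fin.Properties as Finₚ
open import Data.List using (List; []; _∷_; map; filterᵇ; allFin; length; lookup)
open import Data.List.Extrema.Nat using (argmin; argmax; argmin-sel; argmax-sel; f[argmin]≤f[xs]; f[xs]≤f[argmax])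
open import Data.List.Membership.Propositional using (_∈_)
open import Data.List.Membership.Propositional.Properties using (∈-filter⁺; ∈-filter⁻; ∈-allFin; ∈-lookup; ∈-map⁺)
open import Data.List.Properties using (foldr-preservesᵇ; foldr-preservesᵒ)
import Data.List.Relation.Unary.All as All
import Data.List.Relation.Unary.All.Properties as Allₚ
open import Data.List.Relation.Unary.AllPairs using ([]; _∷_)
open import Data.List.Relation.Unary.Any as Any using (here; there)
open import Data.List.Relation.Unary.Any.Properties using (lookup-index)
open import Data.List.Relation.Unary.Unique.Propositional using (Unique)
open import Data.List.Relation.Unary.Unique.Propositional.Properties using (allFin⁺; filter⁺)
import Data.Nat as ℕ
open import Data.Nat using (ℕ; suc; _+_; _*_; _⊔_; _≤_; _<_; _<ᵇ_; z≤n; z<s)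
open import Data.Nat.ListAction using (sum)
import Data.Nat.Properties as ℕₚ
open import Algebra.Properties.CommutativeSemigroup ℕₚ.+-commutativeSemigroup using (xy∙z≈xz∙y)
open import Data.Product using (∃; _×_; _,_; proj₁; proj₂; uncurry)
import Data.Sum as Sum
open import Data.Sum using (_⊎_; inj₁; inj₂; [_,_]′)
import Data.Vec as Vec
open import Data.Vec using ([]; _∷_)
open import Function using (_∘_; Injective; Equivalence; mk⇔)
open import Relation.Binary.PropositionalEquality
  using (_≡_; _≢_; refl; sym; trans; cong; cong₂; subst; subst₂; module ≡-Reasoning)
open import Relation.Nullary using (¬_)
open import Relation.Nullary.Decidable
  using (Dec; yes; no; does; T?; _×-dec_; _⊎-dec_; map′; toWitness; dec-true; dec-false; does-⇔)

_∈Im_ : {A : Set} {k : ℕ} → A → (Fin k → A) → Set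
x ∈Im f = ∃ λ i → f i ≡ x

Unique-lookup-injective : {A : Set} {xs : List A} → Unique xs →
  ∀ i j → lookup xs i ≡ lookup xs j → i ≡ j
Unique-lookup-injective (_ ∷ _) zero zero _ = refl
Unique-lookup-injective (x∉ ∷ _) zero (suc j) eq = ⊥-elim (All.lookup x∉ (∈-lookup j) eq)
Unique-lookup-injective (x∉ ∷ _) (suc i) zero eq = ⊥-elim (All.lookup x∉ (∈-lookup i) (sym eq))
Unique-lookup-injective (_ ∷ u) (suc i) (suc j) eq = cong suc (Unique-lookup-injective u i j eq)

module _ {m : ℕ} (p : Fin m → Bool) where

  members : List (Fin m)
  members = filterᵇ p (allFin m)

  private
    count-list : ∀ xs → sum (map (λ v → if p v then 1 else 0) xs) ≡ length (filterᵇ p xs)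
    count-list [] = refl
    count-list (x ∷ xs) with p x
    ... | true = cong suc (count-list xs)
    ... | false = count-list xs

  count≡length-members : count p ≡ length members
  count≡length-members = count-list (allFin m)

  ∈-members : ∀ {v} → p v ≡ true → v ∈ members
  ∈-members pv = ∈-filter⁺ (T? ∘ p) (∈-allFin _) (Equivalence.from T-≡ pv)

  members-true : ∀ {v} → v ∈ members → p v ≡ true
  members-true v∈ = Equivalence.to T-≡ (proj₂ (∈-filter⁻ (T? ∘ p) {xs = allFin m} v∈))

  ∈Im-members : ∀ {v} → p v ≡ true → v ∈Im lookup members
  ∈Im-members pv = Any.index (∈-members pv) , sym (lookup-index (∈-members pv))

  covered⇒count≤ : ∀ {k} (g : Fin k → Fin m) → (∀ v → p v ≡ true → v ∈Im g) → count p ≤ k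
  covered⇒count≤ g cover rewrite count≡length-members = Finₚ.injective⇒≤ h-injective
    where
    h : Fin (length members) → Fin _
    h i = proj₁ (cover (lookup members i) (members-true (∈-lookup i)))
    g∘h : ∀ i → g (h i) ≡ lookup members i
    g∘h i = proj₂ (cover (lookup members i) (members-true (∈-lookup i)))
    h-injective : Injective _≡_ _≡_ h
    h-injective {i} {j} eq = Unique-lookup-injective (filter⁺ (T? ∘ p) (allFin⁺ m)) i j
      (trans (sym (g∘h i)) (trans (cong g eq) (g∘h j)))

  injective⇒≤count : ∀ {k} (f : Fin k → Fin m) → Injective _≡_ _≡_ f → (∀ i → p (f i) ≡ true) → k ≤ count p
  injective⇒≤count f f-injective pf rewrite count≡length-members =
    Finₚ.injective⇒≤ λ {i} {j} eq → f-injective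
      (trans (sym (proj₂ (∈Im-members (pf i)))) (trans (cong (lookup members) eq) (proj₂ (∈Im-members (pf j)))))

  least : ∀ {v₀} → p v₀ ≡ true → ∃ λ v → p v ≡ true × (∀ w → p w ≡ true → toℕ v ≤ toℕ w)
  least {v₀} pv₀ = v , pv , λ w pw → All.lookup (f[argmin]≤f[xs] v₀ members) (∈-members pw)
    where
    v = argmin toℕ v₀ members
    pv : p v ≡ true
    pv with argmin-sel toℕ v₀ members
    ... | inj₁ eq = subst (λ x → p x ≡ true) (sym eq) pv₀
    ... | inj₂ v∈ = members-true v∈

  greatest : ∀ {v₀} → p v₀ ≡ true → ∃ λ v → p v ≡ true × (∀ w → p w ≡ true → toℕ w ≤ toℕ v)
  greatest {v₀} pv₀ = v , pv , λ w pw → All.lookup (f[xs]≤f[argmax] v₀ members) (∈-members pw)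
    where
    v = argmax toℕ v₀ members
    pv : p v ≡ true
    pv with argmax-sel toℕ v₀ members
    ... | inj₁ eq = subst (λ x → p x ≡ true) (sym eq) pv₀
    ... | inj₂ v∈ = members-true v∈

count-mono : ∀ {m} {p q : Fin m → Bool} → (∀ v → p v ≡ true → q v ≡ true) → count p ≤ count q
count-mono {p = p} {q} p⊆q = subst (count p ≤_) (sym (count≡length-members q))
  (covered⇒count≤ p (lookup (members q)) λ v pv → ∈Im-members q (p⊆q v pv))

count-empty : ∀ {m} {p : Fin m → Bool} → (∀ v → p v ≢ true) → count p ≤ 0
count-empty {p = p} none = covered⇒count≤ p (λ ()) λ v pv → ⊥-elim (none v pv)

module _ {A : Set} where

  sum-map-*ˡ : ∀ d (f : A → ℕ) xs → sum (map (λ x → d * f x) xs) ≡ d * sum (map f xs)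
  sum-map-*ˡ d f [] = sym (ℕₚ.*-zeroʳ d)
  sum-map-*ˡ d f (x ∷ xs) = trans (cong (d * f x +_) (sum-map-*ˡ d f xs)) (sym (ℕₚ.*-distribˡ-+ d (f x) _))

  sum-map-mono : {f g : A → ℕ} → (∀ x → f x ≤ g x) → ∀ xs → sum (map f xs) ≤ sum (map g xs)
  sum-map-mono f≤g [] = z≤n
  sum-map-mono f≤g (x ∷ xs) = ℕₚ.+-mono-≤ (f≤g x) (sum-map-mono f≤g xs)

  sum-map-mono-+ : {f g : A → ℕ} {d : ℕ} → (∀ x → f x ≤ g x) →
    ∀ {x xs} → x ∈ xs → f x + d ≤ g x → sum (map f xs) + d ≤ sum (map g xs)
  sum-map-mono-+ {f} {g} {d} f≤g {xs = x ∷ xs} (here refl) fx+d≤gx = begin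
    f x + sum (map f xs) + d   ≡⟨ xy∙z≈xz∙y (f x) _ d ⟩
    f x + d + sum (map f xs)   ≤⟨ ℕₚ.+-mono-≤ fx+d≤gx (sum-map-mono f≤g xs) ⟩
    g x + sum (map g xs)       ∎
    where open ℕₚ.≤-Reasoning
  sum-map-mono-+ {f} {g} {d} f≤g {xs = y ∷ xs} (there x∈xs) fx+d≤gx = begin
    f y + sum (map f xs) + d   ≡⟨ ℕₚ.+-assoc (f y) _ d ⟩
    f y + (sum (map f xs) + d) ≤⟨ ℕₚ.+-mono-≤ (f≤g y) (sum-map-mono-+ f≤g x∈xs fx+d≤gx) ⟩
    g y + sum (map g xs)       ∎
    where open ℕₚ.≤-Reasoning

Δ-lub : ∀ (G : Graph) {b} → (∀ u → degree G u ≤ b) → Δ G ≤ b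
Δ-lub G {b} deg≤b = foldr-preservesᵇ {P = _≤ b} {f = _⊔_} ℕₚ.⊔-lub z≤n
  (Allₚ.map⁺ {xs = allFin (n G)} (All.tabulate λ {u} _ → deg≤b u))

degree≤Δ : ∀ (G : Graph) u → degree G u ≤ Δ G
degree≤Δ G u = foldr-preservesᵒ (λ x y → [ ℕₚ.m≤n⇒m≤n⊔o y , ℕₚ.m≤n⇒m≤o⊔n x ]′) 0 _
  (inj₂ (Any.map ℕₚ.≤-reflexive (∈-map⁺ (degree G) (∈-allFin u))))

-- forward (E H) u is the summand of u in the definition of |E| H.
forward : ∀ {m} → (Fin m → Fin m → Bool) → Fin m → Fin m → Bool
forward R u v = if toℕ u <ᵇ toℕ v then R u v else false

forward-intro : ∀ {m} (R : Fin m → Fin m → Bool) {u v} → toℕ u < toℕ v → R u v ≡ true → forward R u v ≡ true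
forward-intro R {u} {v} u<v Ruv rewrite Equivalence.to T-≡ (ℕₚ.<⇒<ᵇ u<v) = Ruv

forward-elim : ∀ {m} (R : Fin m → Fin m → Bool) {u v} → forward R u v ≡ true → toℕ u < toℕ v × R u v ≡ true
forward-elim R {u} {v} fwd with toℕ u <ᵇ toℕ v in u<ᵇv
... | true = ℕₚ.<ᵇ⇒< (toℕ u) (toℕ v) (Equivalence.from T-≡ u<ᵇv) , fwd

ForwardDegree≤ : ℕ → Graph → Set
ForwardDegree≤ d G = ∀ u → count (forward (adj G) u) ≤ d

adj⇒≢ : ∀ (G : Graph) {u v} → adj G u v ≡ true → u ≢ v
adj⇒≢ G Guv refl with trans (sym Guv) (irrefl G _)
... | ()

module _ {G : Graph} (H : Subgraph G) where

  degH-least≤forward : ∀ {v} → (∀ w → V H w ≡ true → toℕ v ≤ toℕ w) →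
    degH H v ≤ count (forward (adj G) v)
  degH-least≤forward {v} v-least = count-mono λ w Evw →
    let Gvw , _ , Vw = E⊆ H v w Evw in
    forward-intro (adj G) (ℕₚ.≤∧≢⇒< (v-least w Vw) (adj⇒≢ G Gvw ∘ Finₚ.toℕ-injective)) Gvw

  forwardH-greatest≤0 : ∀ {v} → (∀ w → V H w ≡ true → toℕ w ≤ toℕ v) →
    count (forward (E H) v) ≤ 0
  forwardH-greatest≤0 {v} v-greatest = count-empty λ w fwd →
    let v<w , Evw = forward-elim (E H) fwd
        _ , _ , Vw = E⊆ H v w Evw in
    ℕₚ.<⇒≱ v<w (v-greatest w Vw)

  -- The bound is the summand of u in d * |V| H.
  forwardH≤ : ∀ {d} → ForwardDegree≤ d G → ∀ u → count (forward (E H) u) ≤ d * (if V H u then 1 else 0)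
  forwardH≤ {d} fwd≤d u with V H u in Hu
  ... | true = subst (_ ≤_) (sym (ℕₚ.*-identityʳ d)) (ℕₚ.≤-trans (count-mono E→G) (fwd≤d u))
    where
    E→G : ∀ w → forward (E H) u w ≡ true → forward (adj G) u w ≡ true
    E→G w fwd = let u<w , Euw = forward-elim (E H) fwd in forward-intro (adj G) u<w (proj₁ (E⊆ H u w Euw))
  ... | false = ℕₚ.≤-trans (count-empty no-edge) z≤n
    where
    no-edge : ∀ w → forward (E H) u w ≢ true
    no-edge w fwd with () ← trans (sym (proj₁ (proj₂ (E⊆ H u w (proj₂ (forward-elim (E H) fwd)))))) Hu

degenerate : ∀ {d} {G : Graph} → ForwardDegree≤ d G → (H : Subgraph G) → Nonempty H →
  ∃ λ v → V H v ≡ true × degH H v ≤ d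
degenerate fwd≤d H (_ , Hv₀) =
  let v , Hv , v-least = least (V H) Hv₀ in
  v , Hv , ℕₚ.≤-trans (degH-least≤forward H v-least) (fwd≤d v)

|E|+d≤d*|V| : ∀ {d} {G : Graph} → ForwardDegree≤ d G → (H : Subgraph G) → Nonempty H →
  |E| H + d ≤ d * |V| H
|E|+d≤d*|V| {d} {G} fwd≤d H (_ , Hv₀) with greatest (V H) Hv₀
... | v , Hv , v-greatest = subst (|E| H + d ≤_) (sum-map-*ˡ d _ (allFin (n G)))
  (sum-map-mono-+ (forwardH≤ H fwd≤d) (∈-allFin v) bound-at-v)
  where
  open ℕₚ.≤-Reasoning
  bound-at-v : count (forward (E H) v) + d ≤ d * (if V H v then 1 else 0)
  bound-at-v rewrite Hv = begin
    count (forward (E H) v) + d ≤⟨ ℕₚ.+-monoˡ-≤ d (forwardH-greatest≤0 H v-greatest) ⟩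
    d                           ≡⟨ sym (ℕₚ.*-identityʳ d) ⟩
    d * 1                       ∎

mad<4 : ∀ {G : Graph} → ForwardDegree≤ 2 G → MadLessThan4 G
mad<4 fwd≤2 H nonempty = begin-strict
  2 * |E| H       <⟨ ℕₚ.m<m+n (2 * |E| H) {4} z<s ⟩
  2 * |E| H + 4   ≡⟨ sym (ℕₚ.*-distribˡ-+ 2 (|E| H) 2) ⟩
  2 * (|E| H + 2) ≤⟨ ℕₚ.*-monoʳ-≤ 2 (|E|+d≤d*|V| fwd≤2 H nonempty) ⟩
  2 * (2 * |V| H) ≡⟨ sym (ℕₚ.*-assoc 2 2 (|V| H)) ⟩
  4 * |V| H       ∎
  where open ℕₚ.≤-Reasoning

clique⇒≤colours : ∀ {G : Graph} {q k} (f : Fin q → Fin (n G)) → (∀ i j → i ≢ j → AdjSq G (f i) (f j)) →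
  (c : Fin (n G) → Fin k) → ProperSqColouring G k c → q ≤ k
clique⇒≤colours f clique c proper = Finₚ.injective⇒≤ c∘f-injective
  where
  c∘f-injective : Injective _≡_ _≡_ (c ∘ f)
  c∘f-injective {i} {j} same-colour with i Finₚ.≟ j
  ... | yes i≡j = i≡j
  ... | no i≢j = ⊥-elim (proper (f i) (f j) (clique i j i≢j) same-colour)

module _ {A : Set} where

  _⊕_ : ∀ {k l} → (Fin k → A) → (Fin l → A) → Fin (k + l) → A
  _⊕_ {k} f g = [ f , g ]′ ∘ splitAt k

  ⊕-↑ˡ : ∀ {k l} (f : Fin k → A) (g : Fin l → A) i → (f ⊕ g) (i ↑ˡ l) ≡ f i
  ⊕-↑ˡ {k} {l} f g i = cong [ f , g ]′ (Finₚ.splitAt-↑ˡ k i l)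

  ⊕-↑ʳ : ∀ {k l} (f : Fin k → A) (g : Fin l → A) i → (f ⊕ g) (k ↑ʳ i) ≡ g i
  ⊕-↑ʳ {k} {l} f g i = cong [ f , g ]′ (Finₚ.splitAt-↑ʳ k l i)

  ∈Im-⊕ˡ : ∀ {k l} {f : Fin k → A} (g : Fin l → A) {x} → x ∈Im f → x ∈Im (f ⊕ g)
  ∈Im-⊕ˡ {l = l} {f} g (i , fi≡x) = i ↑ˡ l , trans (⊕-↑ˡ f g i) fi≡x

  ∈Im-⊕ʳ : ∀ {k l} (f : Fin k → A) {g : Fin l → A} {x} → x ∈Im g → x ∈Im (f ⊕ g)
  ∈Im-⊕ʳ {k} f {g} (i , gi≡x) = k ↑ʳ i , trans (⊕-↑ʳ f g i) gi≡x

  grid : ∀ {k l} → (Fin k → Fin l → A) → Fin (k * l) → A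
  grid {l = l} f = uncurry f ∘ remQuot l

  grid-combine : ∀ {k l} (f : Fin k → Fin l → A) i j → grid f (combine i j) ≡ f i j
  grid-combine f i j = cong (uncurry f) (Finₚ.remQuot-combine i j)

  gridOver : ∀ {m l} (p : Fin m → Bool) → (Fin m → Fin l → A) → Fin (length (members p) * l) → A
  gridOver p f = grid (f ∘ lookup (members p))

  ∈Im-gridOver : ∀ {m l} (p : Fin m → Bool) (f : Fin m → Fin l → A) {v} → p v ≡ true → ∀ j → f v j ∈Im gridOver p f
  ∈Im-gridOver p f pv j =
    let c , c↦v = ∈Im-members p pv in
    combine c j , trans (grid-combine (f ∘ lookup (members p)) c j) (cong (λ w → f w j) c↦v)

-- The ten edges {end₁ e, end₂ e} of K₅.
end₁ end₂ : Fin 10 → Fin 5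
end₁ = Vec.lookup (# 0 ∷ # 0 ∷ # 0 ∷ # 0 ∷ # 1 ∷ # 1 ∷ # 1 ∷ # 2 ∷ # 2 ∷ # 3 ∷ [])
end₂ = Vec.lookup (# 1 ∷ # 2 ∷ # 3 ∷ # 4 ∷ # 2 ∷ # 3 ∷ # 4 ∷ # 3 ∷ # 4 ∷ # 4 ∷ [])

Incident : Fin 5 → Fin 10 → Set
Incident a e = a ≡ end₁ e ⊎ a ≡ end₂ e

Incident? : ∀ a e → Dec (Incident a e)
Incident? a e = (a Finₚ.≟ end₁ e) ⊎-dec (a Finₚ.≟ end₂ e)

-- The fifteen pairs {left p, right p} of disjoint edges of K₅ (the edges of the Petersen graph).
left right : Fin 15 → Fin 10
left  = Vec.lookup (# 0 ∷ # 0 ∷ # 0 ∷ # 1 ∷ # 1 ∷ # 1 ∷ # 2 ∷ # 2 ∷ # 2 ∷ # 3 ∷ # 3 ∷ # 3 ∷ # 4 ∷ # 5 ∷ # 6 ∷ [])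
right = Vec.lookup (# 7 ∷ # 8 ∷ # 9 ∷ # 5 ∷ # 6 ∷ # 9 ∷ # 4 ∷ # 6 ∷ # 8 ∷ # 4 ∷ # 5 ∷ # 7 ∷ # 9 ∷ # 8 ∷ # 7 ∷ [])

incidentᵇ : Fin 5 → Fin 10 → Bool
incidentᵇ a e = does (Incident? a e)

leftᵇ rightᵇ : Fin 10 → Fin 15 → Bool
leftᵇ  e p = does (left p Finₚ.≟ e)
rightᵇ e p = does (right p Finₚ.≟ e)

-- Checked by evaluation; abstract so that later type checking never unfolds the decision procedures.
abstract
  K5-degree≤4 : ∀ a → length (members (incidentᵇ a)) ≤ 4
  K5-degree≤4 = toWitness {a? = Finₚ.all? λ a → length (members (incidentᵇ a)) ℕ.≤? 4} _

  disjoint-edges≤3 : ∀ e → length (members (leftᵇ e)) + length (members (rightᵇ e)) ≤ 3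
  disjoint-edges≤3 = toWitness {a? = Finₚ.all? λ e →
    length (members (leftᵇ e)) + length (members (rightᵇ e)) ℕ.≤? 3} _

  edges-meet-or-disjoint : ∀ e e' → (∃ λ a → Incident a e × Incident a e') ⊎
    ((∃ λ p → left p ≡ e × right p ≡ e') ⊎ (∃ λ p → left p ≡ e' × right p ≡ e))
  edges-meet-or-disjoint = toWitness {a? = Finₚ.all? λ e → Finₚ.all? λ e' →
    Finₚ.any? (λ a → Incident? a e ×-dec Incident? a e') ⊎-dec
    (Finₚ.any? (λ p → (left p Finₚ.≟ e) ×-dec (right p Finₚ.≟ e')) ⊎-dec
     Finₚ.any? (λ p → (left p Finₚ.≟ e') ×-dec (right p Finₚ.≟ e)))} _

does⇒ : ∀ {A : Set} (a? : Dec A) → does a? ≡ true → A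
does⇒ (yes a) _ = a

module Construction (t : ℕ) where

  data Vertex : Set where
    bridge : Fin 15 → Fin t → Fin t → Vertex
    mid    : Fin 10 → Fin t → Vertex
    hub    : Fin 5 → Vertex

  infix 4 _◁_
  data _◁_ : Vertex → Vertex → Set where
    bridge◁left  : ∀ {p j k} → bridge p j k ◁ mid (left p) j
    bridge◁right : ∀ {p j k} → bridge p j k ◁ mid (right p) k
    mid◁end₁     : ∀ {e i} → mid e i ◁ hub (end₁ e)
    mid◁end₂     : ∀ {e i} → mid e i ◁ hub (end₂ e)

  incident⇒◁ : ∀ {a e i} → Incident a e → mid e i ◁ hub a
  incident⇒◁ (inj₁ refl) = mid◁end₁
  incident⇒◁ (inj₂ refl) = mid◁end₂

  _◁?_ : ∀ x y → Dec (x ◁ y)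
  bridge p j k ◁? mid e i = map′ to from
    (((e Finₚ.≟ left p) ×-dec (i Finₚ.≟ j)) ⊎-dec ((e Finₚ.≟ right p) ×-dec (i Finₚ.≟ k)))
    where
    to : (e ≡ left p × i ≡ j) ⊎ (e ≡ right p × i ≡ k) → bridge p j k ◁ mid e i
    to (inj₁ (refl , refl)) = bridge◁left
    to (inj₂ (refl , refl)) = bridge◁right
    from : bridge p j k ◁ mid e i → (e ≡ left p × i ≡ j) ⊎ (e ≡ right p × i ≡ k)
    from bridge◁left = inj₁ (refl , refl)
    from bridge◁right = inj₂ (refl , refl)
  mid e i ◁? hub a = map′ incident⇒◁ (λ { mid◁end₁ → inj₁ refl ; mid◁end₂ → inj₂ refl }) (Incident? a e)
  bridge _ _ _ ◁? bridge _ _ _ = no λ ()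
  bridge _ _ _ ◁? hub _        = no λ ()
  mid _ _      ◁? bridge _ _ _ = no λ ()
  mid _ _      ◁? mid _ _      = no λ ()
  hub _        ◁? _            = no λ ()

  Adjacent : Vertex → Vertex → Set
  Adjacent x y = x ◁ y ⊎ y ◁ x

  Adjacent? : ∀ x y → Dec (Adjacent x y)
  Adjacent? x y = (x ◁? y) ⊎-dec (y ◁? x)

  ◁-irreflexive : ∀ {x} → ¬ x ◁ x
  ◁-irreflexive ()

  B M : ℕ
  B = 15 * (t * t)
  M = 10 * t

  decode : Fin (B + (M + 5)) → Vertex
  decode = grid (grid ∘ bridge) ⊕ (grid mid ⊕ hub)

  encode : Vertex → Fin (B + (M + 5))
  encode (bridge p j k) = combine p (combine j k) ↑ˡ (M + 5)
  encode (mid e i)      = B ↑ʳ (combine e i ↑ˡ 5)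
  encode (hub a)        = B ↑ʳ (M ↑ʳ a)

  decode-encode : ∀ x → decode (encode x) ≡ x
  decode-encode (bridge p j k) = trans (⊕-↑ˡ (grid (grid ∘ bridge)) (grid mid ⊕ hub) _)
    (trans (grid-combine (grid ∘ bridge) p _) (grid-combine (bridge p) j k))
  decode-encode (mid e i) = trans (⊕-↑ʳ (grid (grid ∘ bridge)) (grid mid ⊕ hub) _)
    (trans (⊕-↑ˡ (grid mid) hub _) (grid-combine mid e i))
  decode-encode (hub a) = trans (⊕-↑ʳ (grid (grid ∘ bridge)) (grid mid ⊕ hub) _) (⊕-↑ʳ (grid mid) hub a)

  encode-decode : ∀ u → encode (decode u) ≡ u
  encode-decode u = trans (encode-on (splitAt B u)) (Finₚ.join-splitAt B (M + 5) u)
    where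
    encode-bridges : ∀ x → encode (grid (grid ∘ bridge) x) ≡ x ↑ˡ (M + 5)
    encode-bridges x = cong (_↑ˡ (M + 5)) (trans
      (cong (combine (proj₁ r)) (Finₚ.combine-remQuot {t} t (proj₂ r)))
      (Finₚ.combine-remQuot (t * t) x))
      where r = remQuot {15} (t * t) x
    encode-on-rest : ∀ s → encode ([ grid mid , hub ]′ s) ≡ B ↑ʳ Fin.join M 5 s
    encode-on-rest (inj₁ z) = cong (λ w → B ↑ʳ (w ↑ˡ 5)) (Finₚ.combine-remQuot {10} t z)
    encode-on-rest (inj₂ a) = refl
    encode-on : ∀ s → encode ([ grid (grid ∘ bridge) , grid mid ⊕ hub ]′ s) ≡ Fin.join B (M + 5) s
    encode-on (inj₁ x) = encode-bridges x
    encode-on (inj₂ y) = trans (encode-on-rest (splitAt M y)) (cong (B ↑ʳ_) (Finₚ.join-splitAt M 5 y))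

  ◁⇒encode< : ∀ {x y} → x ◁ y → toℕ (encode x) < toℕ (encode y)
  ◁⇒encode< {bridge p j k} {mid e i} _ = begin-strict
    toℕ (c ↑ˡ (M + 5))           ≡⟨ Finₚ.toℕ-↑ˡ c (M + 5) ⟩
    toℕ c                        <⟨ Finₚ.toℕ<n c ⟩
    B                            ≤⟨ ℕₚ.m≤m+n B _ ⟩
    B + toℕ (combine e i ↑ˡ 5)   ≡⟨ sym (Finₚ.toℕ-↑ʳ B _) ⟩
    toℕ (B ↑ʳ (combine e i ↑ˡ 5)) ∎
    where open ℕₚ.≤-Reasoning
          c = combine p (combine j k)
  ◁⇒encode< {mid e i} {hub a} _ = begin-strict
    toℕ (B ↑ʳ (c ↑ˡ 5)) ≡⟨ Finₚ.toℕ-↑ʳ B _ ⟩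
    B + toℕ (c ↑ˡ 5)    ≡⟨ cong (B +_) (Finₚ.toℕ-↑ˡ c 5) ⟩
    B + toℕ c           <⟨ ℕₚ.+-monoʳ-< B (ℕₚ.<-≤-trans (Finₚ.toℕ<n c) (ℕₚ.m≤m+n M _)) ⟩
    B + (M + toℕ a)     ≡⟨ cong (B +_) (sym (Finₚ.toℕ-↑ʳ M a)) ⟩
    B + toℕ (M ↑ʳ a)    ≡⟨ sym (Finₚ.toℕ-↑ʳ B _) ⟩
    toℕ (B ↑ʳ (M ↑ʳ a)) ∎
    where open ℕₚ.≤-Reasoning
          c = combine e i

  G : Graph
  G = record
    { n      = B + (M + 5)
    ; adj    = λ u v → does (Adjacent? (decode u) (decode v))
    ; sym    = λ u v → does-⇔ (mk⇔ Sum.swap Sum.swap) (Adjacent? (decode u) (decode v)) (Adjacent? (decode v) (decode u))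
    ; irrefl = λ v → dec-false (Adjacent? (decode v) (decode v)) [ ◁-irreflexive , ◁-irreflexive ]′
    }

  adj⇒Adjacent : ∀ {u v} → adj G u v ≡ true → Adjacent (decode u) (decode v)
  adj⇒Adjacent {u} {v} = does⇒ (Adjacent? (decode u) (decode v))

  Adjacent⇒adj : ∀ {x y} → Adjacent x y → adj G (encode x) (encode y) ≡ true
  Adjacent⇒adj {x} {y} x~y =
    subst₂ (λ x' y' → does (Adjacent? x' y') ≡ true) (sym (decode-encode x)) (sym (decode-encode y)) (dec-true (Adjacent? x y) x~y)

  parentCount childCount : Vertex → ℕ
  parentCount (bridge _ _ _) = 2
  parentCount (mid _ _)      = 2
  parentCount (hub _)        = 0
  childCount (bridge _ _ _) = 0
  childCount (mid e _)      = length (members (leftᵇ e)) * t + length (members (rightᵇ e)) * t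
  childCount (hub a)        = length (members (incidentᵇ a)) * t

  parents : (x : Vertex) → Fin (parentCount x) → Vertex
  parents (bridge p j k) = Vec.lookup (mid (left p) j ∷ mid (right p) k ∷ [])
  parents (mid e i)      = Vec.lookup (hub (end₁ e) ∷ hub (end₂ e) ∷ [])
  parents (hub _)        = λ ()

  children : (x : Vertex) → Fin (childCount x) → Vertex
  children (bridge _ _ _) = λ ()
  children (mid e i)      = gridOver (leftᵇ e) (λ p k → bridge p i k) ⊕ gridOver (rightᵇ e) (λ p j → bridge p j i)
  children (hub a)        = gridOver (incidentᵇ a) mid

  ◁⇒∈parents : ∀ {x y} → x ◁ y → y ∈Im parents x
  ◁⇒∈parents bridge◁left  = zero , refl
  ◁⇒∈parents bridge◁right = suc zero , refl
  ◁⇒∈parents mid◁end₁     = zero , refl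
  ◁⇒∈parents mid◁end₂     = suc zero , refl

  ◁⇒∈children : ∀ {x y} → y ◁ x → y ∈Im children x
  ◁⇒∈children (bridge◁left {p} {j} {k}) = ∈Im-⊕ˡ (gridOver (rightᵇ (left p)) λ p' j' → bridge p' j' j)
    (∈Im-gridOver (leftᵇ (left p)) (λ p' k' → bridge p' j k') (dec-true (left p Finₚ.≟ left p) refl) k)
  ◁⇒∈children (bridge◁right {p} {j} {k}) = ∈Im-⊕ʳ (gridOver (leftᵇ (right p)) λ p' k' → bridge p' k k')
    (∈Im-gridOver (rightᵇ (right p)) (λ p' j' → bridge p' j' k) (dec-true (right p Finₚ.≟ right p) refl) j)
  ◁⇒∈children (mid◁end₁ {e} {i}) = ∈Im-gridOver (incidentᵇ (end₁ e)) mid (dec-true (Incident? (end₁ e) e) (inj₁ refl)) i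
  ◁⇒∈children (mid◁end₂ {e} {i}) = ∈Im-gridOver (incidentᵇ (end₂ e)) mid (dec-true (Incident? (end₂ e) e) (inj₂ refl)) i

  ∈Im-encode : ∀ {k} {f : Fin k → Vertex} {u} → decode u ∈Im f → u ∈Im (encode ∘ f)
  ∈Im-encode {u = u} (i , fi≡u) = i , trans (cong encode fi≡u) (encode-decode u)

  degree≤parents+children : ∀ u → degree G u ≤ parentCount (decode u) + childCount (decode u)
  degree≤parents+children u = covered⇒count≤ (adj G u) (encode ∘ (parents x ⊕ children x)) λ v Guv →
    ∈Im-encode ([ ∈Im-⊕ˡ (children x) ∘ ◁⇒∈parents , ∈Im-⊕ʳ (parents x) ∘ ◁⇒∈children ]′ (adj⇒Adjacent Guv))
    where x = decode u

  forward-degree≤parents : ∀ u → count (forward (adj G) u) ≤ parentCount (decode u)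
  forward-degree≤parents u = covered⇒count≤ (forward (adj G) u) (encode ∘ parents (decode u)) cover
    where
    cover : ∀ v → forward (adj G) u v ≡ true → v ∈Im (encode ∘ parents (decode u))
    cover v fwd = parent (proj₁ (forward-elim (adj G) fwd)) (adj⇒Adjacent (proj₂ (forward-elim (adj G) fwd)))
      where
      parent : toℕ u < toℕ v → Adjacent (decode u) (decode v) → v ∈Im (encode ∘ parents (decode u))
      parent _   (inj₁ u◁v) = ∈Im-encode (◁⇒∈parents u◁v)
      parent u<v (inj₂ v◁u) = ⊥-elim (ℕₚ.<-asym u<v (subst₂ (λ a b → toℕ a < toℕ b)
        (encode-decode v) (encode-decode u) (◁⇒encode< v◁u)))

  parentCount≤2 : ∀ x → parentCount x ≤ 2
  parentCount≤2 (bridge _ _ _) = ℕₚ.≤-refl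
  parentCount≤2 (mid _ _)      = ℕₚ.≤-refl
  parentCount≤2 (hub _)        = z≤n

  neighbourCount≤4t : 2 ≤ t → ∀ x → parentCount x + childCount x ≤ 4 * t
  neighbourCount≤4t 2≤t (bridge _ _ _) = ℕₚ.≤-trans 2≤t (ℕₚ.m≤m+n t _)
  neighbourCount≤4t 2≤t (mid e _) = ℕₚ.+-mono-≤ 2≤t (begin
    length (members (leftᵇ e)) * t + length (members (rightᵇ e)) * t
      ≡⟨ sym (ℕₚ.*-distribʳ-+ t (length (members (leftᵇ e))) _) ⟩
    (length (members (leftᵇ e)) + length (members (rightᵇ e))) * t
      ≤⟨ ℕₚ.*-monoˡ-≤ t (disjoint-edges≤3 e) ⟩
    3 * t ∎)
    where open ℕₚ.≤-Reasoning
  neighbourCount≤4t 2≤t (hub a) = ℕₚ.*-monoˡ-≤ t (K5-degree≤4 a)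

  forward-degree≤2 : ForwardDegree≤ 2 G
  forward-degree≤2 u = ℕₚ.≤-trans (forward-degree≤parents u) (parentCount≤2 (decode u))

  Δ≤4t : 2 ≤ t → Δ G ≤ 4 * t
  Δ≤4t 2≤t = Δ-lub G λ u → ℕₚ.≤-trans (degree≤parents+children u) (neighbourCount≤4t 2≤t (decode u))

  encode-injective : Injective _≡_ _≡_ encode
  encode-injective {x} {y} eq = trans (sym (decode-encode x)) (trans (cong decode eq) (decode-encode y))

  mid-injective : ∀ {e e' i i'} → mid e i ≡ mid e' i' → e ≡ e' × i ≡ i'
  mid-injective refl = refl , refl

  t≤Δ : t ≤ Δ G
  t≤Δ = ℕₚ.≤-trans (injective⇒≤count (adj G hub₀) (encode ∘ mid (# 0)) mid₀-injective mid₀-adjacent)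
          (degree≤Δ G hub₀)
    where
    hub₀ = encode (hub (# 0))
    mid₀-injective : Injective _≡_ _≡_ (encode ∘ mid (# 0))
    mid₀-injective eq = proj₂ (mid-injective {# 0} {# 0} (encode-injective eq))
    mid₀-adjacent : ∀ i → adj G hub₀ (encode (mid (# 0) i)) ≡ true
    mid₀-adjacent i = Adjacent⇒adj {hub (# 0)} {mid (# 0) i} (inj₂ mid◁end₁)

  common-neighbour : ∀ e i e' i' → ∃ λ w → Adjacent (mid e i) w × Adjacent w (mid e' i')
  common-neighbour e i e' i' with edges-meet-or-disjoint e e'
  ... | inj₁ (a , a∈e , a∈e')         = hub a , inj₁ (incident⇒◁ a∈e) , inj₂ (incident⇒◁ a∈e')
  ... | inj₂ (inj₁ (p , refl , refl)) = bridge p i i' , inj₂ bridge◁left , inj₁ bridge◁right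
  ... | inj₂ (inj₂ (p , refl , refl)) = bridge p i' i , inj₂ bridge◁right , inj₁ bridge◁left

  mids-adjacent² : ∀ {e i e' i'} → mid e i ≢ mid e' i' → AdjSq G (encode (mid e i)) (encode (mid e' i'))
  mids-adjacent² {e} {i} {e'} {i'} distinct =
    let w , e~w , w~e' = common-neighbour e i e' i' in
    distinct ∘ encode-injective ,
    inj₂ (encode w , Adjacent⇒adj {mid e i} {w} e~w , Adjacent⇒adj {w} {mid e' i'} w~e')

  mid-grid-injective : Injective _≡_ _≡_ (grid mid)
  mid-grid-injective {z} {z'} eq = begin
    z                                 ≡⟨ sym (Finₚ.combine-remQuot {10} t z) ⟩
    uncurry combine (remQuot t z)     ≡⟨ cong₂ combine (proj₁ (mid-injective eq)) (proj₂ (mid-injective eq)) ⟩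
    uncurry combine (remQuot t z')    ≡⟨ Finₚ.combine-remQuot {10} t z' ⟩
    z'                                ∎
    where open ≡-Reasoning

  χ²≥5Δ/2 : 2 ≤ t → ChiSqAtLeast5Δ/2 G
  χ²≥5Δ/2 2≤t k c proper = begin
    5 * Δ G      ≤⟨ ℕₚ.*-monoʳ-≤ 5 (Δ≤4t 2≤t) ⟩
    5 * (4 * t)  ≡⟨ trans (sym (ℕₚ.*-assoc 5 4 t)) (ℕₚ.*-assoc 2 10 t) ⟩
    2 * (10 * t) ≤⟨ ℕₚ.*-monoʳ-≤ 2 (clique⇒≤colours {G = G} (encode ∘ grid mid)
                      (λ z z' z≢z' → mids-adjacent² (z≢z' ∘ mid-grid-injective)) c proper) ⟩
    2 * k        ∎
    where open ℕₚ.≤-Reasoning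

theorem5 : (N : ℕ) → ∃ λ (G : Graph) →
    TwoDegenerate G × MadLessThan4 G × (N ≤ Δ G) × ChiSqAtLeast5Δ/2 G
theorem5 N =
  G , degenerate forward-degree≤2 , mad<4 forward-degree≤2 ,
  ℕₚ.≤-trans (ℕₚ.m≤n+m N 2) t≤Δ , χ²≥5Δ/2 (ℕₚ.m≤m+n 2 N)
  where open Construction (2 + N)
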